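{- Let $\mathcal{G}$ be a CPR graph on a finite vertex set $\Omega$ with labels $0,1,\dots,r-1$ ($r\geq 1$), and suppose $\mathcal{G}$ has a vertex $A$ incident with exactly one edge, this edge having label $0$, and that every other edge of $\mathcal{G}$ has label at least $1$. Let $B\notin\Omega$ be a new vertex and let $\mathcal{H}$ be the graph on $\Omega\cup\{B\}$ obtained from $\mathcal{G}$ by adding an edge $\{A,B\}$ of label $-1$. Then $\mathcal{H}$, with labels $-1,0,1,\dots,r-1$ ordered increasingly, is a CPR graph. Moreover, if $\mathcal{G}$ is connected (equivalently, $\mathcal{H}$ is connected), then the group represented by $\mathcal{G}$ is the symmetric group on $\Omega$ and the group represented by $\mathcal{H}$ is the symmetric group on $\Omega\cup\{B\}$.
   Context: A string group generated by involutions (sggi) of rank $r$ is a group $G$ together with an ordered sequence $(\rho_0,\dots,\rho_{r-1})$ of involutions generating $G$ such that $(\rho_i\rho_j)^2=1$ whenever $|i-j|\geq 2$. It is a string C-group if moreover $\langle \rho_i : i\in I\rangle\cap\langle\rho_j : j\in J\rangle=\langle \rho_k : k\in I\cap J\rangle$ for all $I,J\subseteq\{0,\dots,r-1\}$. Let $\Omega$ be a finite set and $L$ a set of consecutive integers ordered increasingly. An edge-labelled multigraph on $\Omega$ with labels in $L$, in which every vertex is incident with at most one edge of each label and every label occurs, determines for each $l\in L$ the involution $\rho_l\in\mathrm{Sym}(\Omega)$ equal to the product of the transpositions $(a\,b)$ over the edges $\{a,b\}$ of label $l$; the graph is the permutation representation graph of $\langle\rho_l:l\in L\rangle$ with generating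 sequence $(\rho_l)$ in increasing label order, and it is a CPR graph if this is a string C-group. The group represented by the graph is $\langle\rho_l : l\in L\rangle$. -}

module Defs where

open import Data.Nat using (ℕ; zero; suc; _≤_; ∣_-_∣)
open import Data.Fin using (Fin; zero; suc; toℕ; _≟_)
open import Data.Fin.Subset using (Subset; _∈_; _∩_; ⊤)
open import Data.Fin.Permutation using (Permutation′; _⟨$⟩ʳ_)
open import Data.Maybe using (Maybe; just; nothing)
import Data.Maybe as Maybe
open import Data.List using (List; []; _∷_)
open import Data.List.Relation.Unary.All using (All)
open import Data.Product using (Σ; ∃; ∃-syntax; _×_; _,_)
open import Data.Sum using (_⊎_)
open import Function using (id; _∘_)
open import Relation.Binary.PropositionalEquality using (_≡_; _≢_)
open import Relation.Nullary using (¬_; yes; no)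

-- Since every vertex
-- is incident with at most one edge of each label, the edges of label
-- l are recorded by the partial "partner" map:  partner l a ≡ just b
-- iff {a,b} is an edge of label l.

LGraph : ℕ → ℕ → Set
LGraph n r = Fin r → Fin n → Maybe (Fin n)

IsLGraph : ∀ {n r} → LGraph n r → Set
IsLGraph {n} {r} G =
  (∀ (l : Fin r) (a b : Fin n) → G l a ≡ just b → G l b ≡ just a) ×
  (∀ (l : Fin r) (a : Fin n) → G l a ≢ just a)

AllLabelsOccur : ∀ {n r} → LGraph n r → Set
AllLabelsOccur {n} {r} G = ∀ (l : Fin r) → ∃[ a ] ∃[ b ] (G l a ≡ just b)

-- ρ_l : product of the transpositions (a b) over edges {a,b} of label l
ρ : ∀ {n r} → LGraph n r → Fin r → Fin n → Fin n
ρ G l a = Maybe.maybe id a (G l a)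

evalWord : ∀ {n r} → LGraph n r → List (Fin r) → Fin n → Fin n
evalWord G []      = id
evalWord G (l ∷ w) = ρ G l ∘ evalWord G w

-- membership of a permutation f in ⟨ ρ_i : i ∈ I ⟩.  Since each ρ_i is an
-- involution (and everything is finite), this subgroup consists exactly of
-- the products of generators ρ_i with i ∈ I.
InGen : ∀ {n r} → LGraph n r → Subset r → (Fin n → Fin n) → Set
InGen {n} {r} G I f =
  ∃[ w ] (All (_∈ I) w × (∀ (a : Fin n) → evalWord G w a ≡ f a))

StringCond : ∀ {n r} → LGraph n r → Set
StringCond {n} {r} G =
  ∀ (i j : Fin r) → 2 ≤ ∣ toℕ i - toℕ j ∣ →
    ∀ (a : Fin n) → ρ G i (ρ G j (ρ G i (ρ G j a))) ≡ a

IntersectionProp : ∀ {n r} → LGraph n r → Set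
IntersectionProp {n} {r} G =
  ∀ (I J : Subset r) (f : Fin n → Fin n) →
    ((InGen G I f × InGen G J f) → InGen G (I ∩ J) f) ×
    (InGen G (I ∩ J) f → (InGen G I f × InGen G J f))

-- CPR graph: a well-formed labelled graph in which every label occurs
-- (so each ρ_l is an involution), whose generating sequence
-- (ρ_0,…,ρ_{r-1}) is a string C-group (sggi + intersection property).
IsCPR : ∀ {n r} → LGraph n r → Set
IsCPR G = IsLGraph G × AllLabelsOccur G × StringCond G × IntersectionProp G

data Reach {n r} (G : LGraph n r) : Fin n → Fin n → Set where
  here : ∀ {a} → Reach G a a
  step : ∀ {a b c} (l : Fin r) → G l a ≡ just b → Reach G b c → Reach G a c

Connected : ∀ {n r} → LGraph n r → Set
Connected {n} G = ∀ (a b : Fin n) → Reach G a b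

GroupIsSym : ∀ {n r} → LGraph n r → Set
GroupIsSym {n} {r} G = ∀ (π : Permutation′ n) → InGen G ⊤ (π ⟨$⟩ʳ_)

-- The extension H of G: vertex set Fin (suc n), where the new vertex B
-- is `zero` and the old vertex a ∈ Ω is `suc a`; labels Fin (suc r),
-- where index `zero` is the new label -1 and index `suc l` is label l.

extend : ∀ {n r} → LGraph n r → Fin n → LGraph (suc n) (suc r)
extend G A zero    zero    = just (suc A)
extend G A zero    (suc a) with a ≟ A
... | yes _ = just zero
... | no  _ = nothing
extend G A (suc l) zero    = nothing
extend G A (suc l) (suc a) = Maybe.map suc (G l a)

{-# OPTIONS --safe #-}
module Submission where

-- ρ₀ is the single transposition (A b) and every other generator fixes A, so conjugating along a
-- word shows that (A g(A)) lies in ⟨ρᵢ : i ∈ I⟩ whenever g does. In a connected graph this gives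
-- every transposition, hence the symmetric group; H has the same shape, with ρ₋₁ = (B A).
-- In H, τ = ρ₋₁ commutes with every ρₗ, l ≥ 1, since these fix both B and A: the string condition.
-- As τ g τ is g when g fixes A and (A g(A)) τ g otherwise, every element of ⟨τ, ρᵢ : i ∈ I⟩ is a
-- lift of some g ∈ ⟨ρᵢ : i ∈ I⟩ or has the form g τ h with g, h such lifts. An element of two such
-- subgroups that fixes B is therefore a lift from both, and the intersection property of G
-- applies; one sending B to y puts (A y) into both subgroups of G, hence into their intersection,
-- and τ (A y) f fixes B.

open import Defs
open import Data.Nat using (ℕ; suc)
open import Data.Fin using (Fin; zero; suc)
open import Data.Maybe using (just; nothing)
open import Data.Product using (∃-syntax; _×_)
open import Data.Sum using (_⊎_)
open import Relation.Binary.PropositionalEquality using (_≡_; _≢_)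

open import Data.Bool using (true; false; _∧_)
open import Data.Nat using (_≤_; s≤s)
open import Data.Maybe using (maybe)
import Data.Maybe as Maybe
open import Data.Maybe.Properties using (just-injective)
open import Data.Empty using (⊥-elim)
open import Data.Fin using (_≟_; lift; toℕ)
open import Data.Fin.Properties using (0≢1+n; suc-injective; lift-injective)
open import Data.Fin.Permutation using (_⟨$⟩ʳ_)
open import Data.Fin.Permutation.Components using (transpose; transpose-inverse)
open import Data.Fin.Permutation.Transposition.List using (TranspositionList; eval; decompose; eval-decompose)
open import Data.Fin.Subset using (Subset; _∈_; _⊆_; _∩_; ⊤)
open import Data.Fin.Subset.Properties using (∈⊤; p∩q⊆p; p∩q⊆q)
open import Data.List using ([]; _∷_; _++_; map)
open import Data.List.Relation.Unary.All using (All; []; _∷_; universal)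
import Data.List.Relation.Unary.All as All
open import Data.List.Relation.Unary.All.Properties using (++⁺; map⁺)
open import Data.Product using (_,_; proj₁)
open import Data.Sum using (inj₁; inj₂)
open import Data.Vec.Base using (_∷_; here; there)
open import Function using (id; _∘_)
open import Function.Definitions using (Injective)
open import Function.Consequences.Propositional using (inverseʳ⇒injective; strictlyInverseʳ⇒inverseʳ)
open import Relation.Binary.PropositionalEquality using (refl; sym; trans; cong; subst; module ≡-Reasoning)
open import Relation.Nullary using (Dec; yes; no)
open import Relation.Nullary.Decidable using (dec-true; dec-false)

private
  variable
    m n : ℕ

involutive⇒injective : ∀ {X : Set} {f : X → X} → (∀ x → f (f x) ≡ x) → Injective _≡_ _≡_ f
involutive⇒injective {f = f} f-inv = inverseʳ⇒injective f (strictlyInverseʳ⇒inverseʳ {f⁻¹ = f} f f-inv)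

commuting-involutions : ∀ {X : Set} (f g : X → X) → (∀ x → f (f x) ≡ x) → (∀ x → g (g x) ≡ x) →
                        (∀ x → f (g x) ≡ g (f x)) → ∀ x → f (g (f (g x))) ≡ x
commuting-involutions f g f-inv g-inv fg≗gf x = begin
  f (g (f (g x)))   ≡⟨ fg≗gf (f (g x)) ⟩
  g (f (f (g x)))   ≡⟨ cong g (f-inv (g x)) ⟩
  g (g x)           ≡⟨ g-inv x ⟩
  x                 ∎
  where open ≡-Reasoning

s∷p⊆inside∷p : ∀ {s} {p : Subset n} → s ∷ p ⊆ true ∷ p
s∷p⊆inside∷p here      = here
s∷p⊆inside∷p (there x) = there x

transpose-matchˡ : ∀ (i j : Fin n) → transpose i j i ≡ j
transpose-matchˡ i j rewrite dec-true (i ≟ i) refl = refl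

transpose-matchʳ : ∀ (i j : Fin n) → transpose i j j ≡ i
transpose-matchʳ i j with j ≟ i
... | yes j≡i = j≡i
... | no _ rewrite dec-true (j ≟ j) refl = refl

transpose-fix : ∀ {i j k : Fin n} → k ≢ i → k ≢ j → transpose i j k ≡ k
transpose-fix {i = i} {j} {k} k≢i k≢j rewrite dec-false (k ≟ i) k≢i | dec-false (k ≟ j) k≢j = refl

transpose-same : ∀ (i k : Fin n) → transpose i i k ≡ k
transpose-same i k = by-cases (k ≟ i)
  where
  by-cases : Dec (k ≡ i) → transpose i i k ≡ k
  by-cases (yes refl) = transpose-matchˡ k k
  by-cases (no k≢i)   = transpose-fix k≢i k≢i

transpose-comm : ∀ (i j k : Fin n) → transpose i j k ≡ transpose j i k
transpose-comm i j k = by-cases (k ≟ i) (k ≟ j)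
  where
  by-cases : Dec (k ≡ i) → Dec (k ≡ j) → transpose i j k ≡ transpose j i k
  by-cases (yes refl) _          = trans (transpose-matchˡ k j) (sym (transpose-matchʳ j k))
  by-cases (no _)     (yes refl) = trans (transpose-matchʳ i k) (sym (transpose-matchˡ k i))
  by-cases (no k≢i)   (no k≢j)   = trans (transpose-fix k≢i k≢j) (sym (transpose-fix k≢j k≢i))

transpose-involutive : ∀ (i j k : Fin n) → transpose i j (transpose i j k) ≡ k
transpose-involutive i j k = trans (cong (transpose i j) (transpose-comm i j k)) (transpose-inverse i j)

transpose-conj : ∀ (σ : Fin n → Fin m) → Injective _≡_ _≡_ σ →
                 ∀ i j k → σ (transpose i j k) ≡ transpose (σ i) (σ j) (σ k)
transpose-conj σ σ-inj i j k = by-cases (k ≟ i) (k ≟ j)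
  where
  by-cases : Dec (k ≡ i) → Dec (k ≡ j) → σ (transpose i j k) ≡ transpose (σ i) (σ j) (σ k)
  by-cases (yes refl) _          = trans (cong σ (transpose-matchˡ k j)) (sym (transpose-matchˡ (σ k) (σ j)))
  by-cases (no _)     (yes refl) = trans (cong σ (transpose-matchʳ i k)) (sym (transpose-matchʳ (σ i) (σ k)))
  by-cases (no k≢i)   (no k≢j)   =
    trans (cong σ (transpose-fix k≢i k≢j)) (sym (transpose-fix (k≢i ∘ σ-inj) (k≢j ∘ σ-inj)))

transpose-suc : ∀ (i j : Fin n) k → transpose (suc i) (suc j) k ≡ lift 1 (transpose i j) k
transpose-suc i j zero    = transpose-fix {i = suc i} {suc j} (λ ()) (λ ())
transpose-suc i j (suc k) = sym (transpose-conj suc suc-injective i j k)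

lift-cong : ∀ k {f g : Fin m → Fin n} → (∀ x → f x ≡ g x) → ∀ x → lift k f x ≡ lift k g x
lift-cong 0       f≗g x       = f≗g x
lift-cong (suc k) f≗g zero    = refl
lift-cong (suc k) f≗g (suc x) = cong suc (lift-cong k f≗g x)

lift-id : ∀ k {f : Fin n → Fin n} → (∀ x → f x ≡ x) → ∀ x → lift k f x ≡ x
lift-id 0       f≗id x       = f≗id x
lift-id (suc k) f≗id zero    = refl
lift-id (suc k) f≗id (suc x) = cong suc (lift-id k f≗id x)

lift-∘ : ∀ k {o} (f : Fin n → Fin o) (g : Fin m → Fin n) x → lift k f (lift k g x) ≡ lift k (f ∘ g) x
lift-∘ 0       f g x       = refl
lift-∘ (suc k) f g zero    = refl
lift-∘ (suc k) f g (suc x) = cong suc (lift-∘ k f g x)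

lift-involutive : ∀ k {f : Fin n → Fin n} → (∀ x → f (f x) ≡ x) → ∀ x → lift k f (lift k f x) ≡ x
lift-involutive k {f} f-inv x = trans (lift-∘ k f f x) (lift-id k f-inv x)

module _ {n r : ℕ} (K : LGraph n r) where

  ρ-involutive : IsLGraph K → ∀ l a → ρ K l (ρ K l a) ≡ a
  ρ-involutive (edge-sym , _) l a with K l a in eq
  ... | nothing rewrite eq = refl
  ... | just b rewrite edge-sym l a b eq = refl

  evalWord-++ : ∀ w v a → evalWord K (w ++ v) a ≡ evalWord K w (evalWord K v a)
  evalWord-++ []      v a = refl
  evalWord-++ (l ∷ w) v a = cong (ρ K l) (evalWord-++ w v a)

  evalWord-injective : (∀ l a → ρ K l (ρ K l a) ≡ a) → ∀ w → Injective _≡_ _≡_ (evalWord K w)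
  evalWord-injective ρ-inv []      e = e
  evalWord-injective ρ-inv (l ∷ w) {x} {y} e = evalWord-injective ρ-inv w
    (trans (sym (ρ-inv l _)) (trans (cong (ρ K l) e) (ρ-inv l _)))

  InGen-cong : ∀ {I f g} → InGen K I f → (∀ a → f a ≡ g a) → InGen K I g
  InGen-cong (w , w∈I , w≗f) f≗g = w , w∈I , λ a → trans (w≗f a) (f≗g a)

  InGen-id : ∀ {I} → InGen K I id
  InGen-id = [] , [] , λ _ → refl

  InGen-ρ : ∀ {I l} → l ∈ I → InGen K I (ρ K l)
  InGen-ρ l∈I = _ ∷ [] , l∈I ∷ [] , λ _ → refl

  InGen-∘ : ∀ {I f g} → InGen K I f → InGen K I g → InGen K I (f ∘ g)
  InGen-∘ {f = f} (w , w∈I , w≗f) (v , v∈I , v≗g) =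
    w ++ v , ++⁺ w∈I v∈I , λ a → trans (evalWord-++ w v a) (trans (w≗f _) (cong f (v≗g a)))

  InGen-mono : ∀ {I J f} → I ⊆ J → InGen K I f → InGen K J f
  InGen-mono I⊆J (w , w∈I , w≗f) = w , All.map I⊆J w∈I , w≗f

  InGen-injective : (∀ l a → ρ K l (ρ K l a) ≡ a) → ∀ {I f} → InGen K I f → Injective _≡_ _≡_ f
  InGen-injective ρ-inv (w , _ , w≗f) {x} {y} e =
    evalWord-injective ρ-inv w (trans (w≗f x) (trans e (sym (w≗f y))))

  Reach⇒evalWord : ∀ {a b} → Reach K a b → ∃[ w ] (evalWord K w a ≡ b)
  Reach⇒evalWord here = [] , refl
  Reach⇒evalWord (step {a} l e rest) with Reach⇒evalWord rest
  ... | w , w-moves = w ++ l ∷ [] ,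
    trans (evalWord-++ w (l ∷ []) a) (trans (cong (λ x → evalWord K w (maybe id a x)) e) w-moves)

  Reach-trans : ∀ {a b c} → Reach K a b → Reach K b c → Reach K a c
  Reach-trans here         b↝c = b↝c
  Reach-trans (step l e a↝b) b↝c = step l e (Reach-trans a↝b b↝c)

  ρ-single-edge : IsLGraph K → ∀ l {c d} → K l c ≡ just d →
                  (∀ a b → K l a ≡ just b → a ≡ c ⊎ b ≡ c) →
                  ∀ a → ρ K l a ≡ transpose c d a
  ρ-single-edge (edge-sym , _) l {c} {d} c—d meets-c a = by-cases (a ≟ c) (a ≟ d)
    where
    by-cases : Dec (a ≡ c) → Dec (a ≡ d) → ρ K l a ≡ transpose c d a
    by-cases (yes refl) _          = trans (cong (maybe id a) c—d) (sym (transpose-matchˡ a d))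
    by-cases (no _)     (yes refl) = trans (cong (maybe id a) (edge-sym l c a c—d)) (sym (transpose-matchʳ c a))
    by-cases (no a≢c)   (no a≢d)   = trans no-edge (sym (transpose-fix a≢c a≢d))
      where
      no-edge : ρ K l a ≡ a
      no-edge with K l a in a—b
      ... | nothing = refl
      ... | just b with meets-c a b a—b
      ...   | inj₁ a≡c  = ⊥-elim (a≢c a≡c)
      ...   | inj₂ refl = ⊥-elim (a≢d (just-injective (trans (sym (edge-sym l a c a—b)) c—d)))

module TranspositionGenerator {n r : ℕ} (K : LGraph n r)
  (ρ-inv : ∀ l a → ρ K l (ρ K l a) ≡ a)
  (l₀ : Fin r) (c d : Fin n)
  (ρ-l₀ : ∀ a → ρ K l₀ a ≡ transpose c d a)
  (ρ-fix : ∀ l → l ≢ l₀ → ρ K l c ≡ c) where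

  private
    transpose-c-subst : ∀ {I x y} → x ≡ y → InGen K I (transpose c x) → InGen K I (transpose c y)
    transpose-c-subst {I} = subst (λ x → InGen K I (transpose c x))

    transpose-c-c : ∀ {I} → InGen K I (transpose c c)
    transpose-c-c = InGen-cong K (InGen-id K) (sym ∘ transpose-same c)

    transpose-ρ : ∀ {I x} l → l ∈ I → InGen K I (transpose c x) → InGen K I (transpose c (ρ K l x))
    transpose-ρ {I} {x} l l∈I cx∈I with l ≟ l₀
    ... | yes refl = transpose-c-subst (sym (ρ-l₀ x)) (by-cases (x ≟ c) (x ≟ d))
      where
      by-cases : Dec (x ≡ c) → Dec (x ≡ d) → InGen K I (transpose c (transpose c d x))
      by-cases (yes refl) _          =
        transpose-c-subst (sym (transpose-matchˡ c d)) (InGen-cong K (InGen-ρ K l∈I) ρ-l₀)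
      by-cases (no _)     (yes refl) = transpose-c-subst (sym (transpose-matchʳ c d)) transpose-c-c
      by-cases (no x≢c)   (no x≢d)   = transpose-c-subst (sym (transpose-fix x≢c x≢d)) cx∈I
    ... | no l≢l₀ =
      InGen-cong K (InGen-∘ K (InGen-ρ K l∈I) (InGen-∘ K cx∈I (InGen-ρ K l∈I))) conjugate
      where
      ρₗ : Fin n → Fin n
      ρₗ = ρ K l
      conjugate : ∀ a → ρₗ (transpose c x (ρₗ a)) ≡ transpose c (ρₗ x) a
      conjugate a = begin
        ρₗ (transpose c x (ρₗ a))
          ≡⟨ transpose-conj ρₗ (involutive⇒injective (ρ-inv l)) c x (ρₗ a) ⟩
        transpose (ρₗ c) (ρₗ x) (ρₗ (ρₗ a))
          ≡⟨ cong (λ y → transpose y (ρₗ x) (ρₗ (ρₗ a))) (ρ-fix l l≢l₀) ⟩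
        transpose c (ρₗ x) (ρₗ (ρₗ a))        ≡⟨ cong (transpose c (ρₗ x)) (ρ-inv l a) ⟩
        transpose c (ρₗ x) a                  ∎
        where open ≡-Reasoning

    transpose-evalWord : ∀ {I} w → All (_∈ I) w → InGen K I (transpose c (evalWord K w c))
    transpose-evalWord []      []          = transpose-c-c
    transpose-evalWord (l ∷ w) (l∈I ∷ w∈I) = transpose-ρ l l∈I (transpose-evalWord w w∈I)

  InGen-transpose : ∀ {I g} → InGen K I g → InGen K I (transpose c (g c))
  InGen-transpose (w , w∈I , w≗g) = transpose-c-subst (w≗g c) (transpose-evalWord w w∈I)

  module _ (connected : Connected K) where

    private
      transpose-c : ∀ y → InGen K ⊤ (transpose c y)
      transpose-c y with Reach⇒evalWord K (connected c y)
      ... | w , refl = InGen-transpose (w , universal (λ _ → ∈⊤) w , λ _ → refl)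

      every-transpose : ∀ i j → InGen K ⊤ (transpose i j)
      every-transpose i j = by-cases (i ≟ c) (j ≟ c) (j ≟ i)
        where
        by-cases : Dec (i ≡ c) → Dec (j ≡ c) → Dec (j ≡ i) → InGen K ⊤ (transpose i j)
        by-cases (yes refl) _          _          = transpose-c j
        by-cases (no _)     (yes refl) _          = InGen-cong K (transpose-c i) (transpose-comm j i)
        by-cases (no _)     (no _)     (yes refl) = InGen-cong K (InGen-id K) (λ a → sym (transpose-same j a))
        by-cases (no _)     (no j≢c)   (no j≢i)   =
          InGen-cong K (InGen-∘ K (transpose-c i) (InGen-∘ K (transpose-c j) (transpose-c i))) conjugate
          where
          σ : Fin n → Fin n
          σ = transpose c i
          σ-inj : Injective _≡_ _≡_ σ
          σ-inj = involutive⇒injective (transpose-involutive c i)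
          conjugate : ∀ a → σ (transpose c j (σ a)) ≡ transpose i j a
          conjugate a = begin
            σ (transpose c j (σ a))           ≡⟨ transpose-conj σ σ-inj c j (σ a) ⟩
            transpose (σ c) (σ j) (σ (σ a))   ≡⟨ cong (transpose (σ c) (σ j)) (transpose-involutive c i a) ⟩
            transpose (σ c) (σ j) a           ≡⟨ cong (λ y → transpose y (σ j) a) (transpose-matchˡ c i) ⟩
            transpose i (σ j) a               ≡⟨ cong (λ y → transpose i y a) (transpose-fix j≢c j≢i) ⟩
            transpose i j a                   ∎
            where open ≡-Reasoning

      InGen-eval : ∀ (xs : TranspositionList n) → InGen K ⊤ (eval xs ⟨$⟩ʳ_)
      InGen-eval []             = InGen-id K
      InGen-eval ((i , j) ∷ xs) = InGen-∘ K (InGen-eval xs) (every-transpose i j)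

    connected⇒GroupIsSym : GroupIsSym K
    connected⇒GroupIsSym π = InGen-cong K (InGen-eval (decompose π)) (eval-decompose π)

module _ {n r : ℕ} (G : LGraph n r) (A : Fin n) where

  private
    H : LGraph (suc n) (suc r)
    H = extend G A

  extend-edge-A : H zero (suc A) ≡ just zero
  extend-edge-A with A ≟ A
  ... | yes _   = refl
  ... | no A≢A = ⊥-elim (A≢A refl)

  extend-no-edge : ∀ {a} → a ≢ A → H zero (suc a) ≡ nothing
  extend-no-edge {a} a≢A with a ≟ A
  ... | yes a≡A = ⊥-elim (a≢A a≡A)
  ... | no _    = refl

  ρ-extend-zero : ∀ x → ρ H zero x ≡ transpose zero (suc A) x
  ρ-extend-zero zero    = sym (transpose-matchˡ zero (suc A))
  ρ-extend-zero (suc a) = by-cases (a ≟ A)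
    where
    by-cases : Dec (a ≡ A) → ρ H zero (suc a) ≡ transpose zero (suc A) (suc a)
    by-cases (yes refl) = trans (cong (maybe id (suc a)) extend-edge-A) (sym (transpose-matchʳ zero (suc a)))
    by-cases (no a≢A)   = trans (cong (maybe id (suc a)) (extend-no-edge a≢A))
                                (sym (transpose-fix {i = zero} (λ ()) (a≢A ∘ suc-injective)))

  ρ-extend-fix-zero : ∀ l → l ≢ zero → ρ H l zero ≡ zero
  ρ-extend-fix-zero zero    0≢0 = ⊥-elim (0≢0 refl)
  ρ-extend-fix-zero (suc l) _   = refl

  ρ-extend-suc : ∀ l x → ρ H (suc l) x ≡ lift 1 (ρ G l) x
  ρ-extend-suc l zero    = refl
  ρ-extend-suc l (suc a) with G l a
  ... | nothing = refl
  ... | just _  = refl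

  ρ-extend-suc-lift : ∀ l {m} (g : Fin m → Fin n) x → ρ H (suc l) (lift 1 g x) ≡ lift 1 (ρ G l ∘ g) x
  ρ-extend-suc-lift l g x = trans (ρ-extend-suc l (lift 1 g x)) (lift-∘ 1 (ρ G l) g x)

  evalWord-extend : ∀ w x → evalWord H (map suc w) x ≡ lift 1 (evalWord G w) x
  evalWord-extend []      x = sym (lift-id 1 (λ _ → refl) x)
  evalWord-extend (l ∷ w) x =
    trans (cong (ρ H (suc l)) (evalWord-extend w x)) (ρ-extend-suc-lift l (evalWord G w) x)

  InGen-extend : ∀ {I g} β → InGen G I g → InGen H (β ∷ I) (lift 1 g)
  InGen-extend β (w , w∈I , w≗g) =
    map suc w , map⁺ (All.map there w∈I) , λ x → trans (evalWord-extend w x) (lift-cong 1 w≗g x)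

  extend-IsLGraph : IsLGraph G → IsLGraph H
  extend-IsLGraph (edge-sym , loopless) = H-edge-sym , H-loopless
    where
    H-edge-sym : ∀ l a b → H l a ≡ just b → H l b ≡ just a
    H-edge-sym zero    zero    b refl = extend-edge-A
    H-edge-sym zero    (suc a) b e with a ≟ A
    H-edge-sym zero    (suc a) b refl | yes refl = refl
    H-edge-sym (suc l) (suc a) b e with G l a in a—c
    H-edge-sym (suc l) (suc a) b refl | just c rewrite edge-sym l a c a—c = refl

    H-loopless : ∀ l a → H l a ≢ just a
    H-loopless zero    zero    ()
    H-loopless zero    (suc a) e with a ≟ A
    H-loopless zero    (suc a) () | yes _
    H-loopless zero    (suc a) () | no _
    H-loopless (suc l) zero    ()
    H-loopless (suc l) (suc a) e with G l a in a—c
    H-loopless (suc l) (suc a) refl | just .a = loopless l a a—c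

  extend-AllLabelsOccur : AllLabelsOccur G → AllLabelsOccur H
  extend-AllLabelsOccur occurs zero    = zero , suc A , refl
  extend-AllLabelsOccur occurs (suc l) with occurs l
  ... | a , b , a—b = suc a , suc b , cong (Maybe.map suc) a—b

  extend-Connected : Connected G → Connected H
  extend-Connected connected = λ where
      zero    zero    → here
      zero    (suc y) → step zero refl (lift-Reach (connected A y))
      (suc x) zero    → Reach-trans H (lift-Reach (connected x A)) (step zero extend-edge-A here)
      (suc x) (suc y) → lift-Reach (connected x y)
    where
    lift-Reach : ∀ {a b} → Reach G a b → Reach H (suc a) (suc b)
    lift-Reach here            = here
    lift-Reach (step l e a↝b)  = step (suc l) (cong (Maybe.map suc) e) (lift-Reach a↝b)

module _ {n k : ℕ} (G : LGraph n (suc k)) (A : Fin n) (G-lgraph : IsLGraph G)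
         (A-fixed : ∀ l → l ≢ zero → ρ G l A ≡ A) where

  private
    H : LGraph (suc n) (suc (suc k))
    H = extend G A

    H-inv : ∀ l x → ρ H l (ρ H l x) ≡ x
    H-inv = ρ-involutive H (extend-IsLGraph G A G-lgraph)

    ρ-extend-commute : ∀ l → l ≢ zero → ∀ x → ρ H zero (ρ H (suc l) x) ≡ ρ H (suc l) (ρ H zero x)
    ρ-extend-commute l l≢0 x = begin
      ρ H zero (ρ′ x)                                ≡⟨ ρ-extend-zero G A (ρ′ x) ⟩
      transpose zero (suc A) (ρ′ x)                  ≡⟨ cong (λ y → transpose zero y (ρ′ x)) (sym ρ′-fixes-A) ⟩
      transpose (ρ′ zero) (ρ′ (suc A)) (ρ′ x)        ≡⟨ sym (transpose-conj ρ′ ρ′-inj zero (suc A) x) ⟩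
      ρ′ (transpose zero (suc A) x)                  ≡⟨ cong ρ′ (sym (ρ-extend-zero G A x)) ⟩
      ρ′ (ρ H zero x)                                ∎
      where
      open ≡-Reasoning
      ρ′ : Fin (suc n) → Fin (suc n)
      ρ′ = ρ H (suc l)
      ρ′-inj : Injective _≡_ _≡_ ρ′
      ρ′-inj = involutive⇒injective (H-inv (suc l))
      ρ′-fixes-A : ρ′ (suc A) ≡ suc A
      ρ′-fixes-A = trans (ρ-extend-suc G A l (suc A)) (cong suc (A-fixed l l≢0))

    nonzero : ∀ {l : Fin (suc k)} → 2 ≤ suc (toℕ l) → l ≢ zero
    nonzero {zero} (s≤s ()) refl

  extend-StringCond : StringCond G → StringCond H
  extend-StringCond string zero    zero    ()
  extend-StringCond string zero    (suc j) 2≤j =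
    commuting-involutions (ρ H zero) (ρ H (suc j)) (H-inv zero) (H-inv (suc j))
      (ρ-extend-commute j (nonzero 2≤j))
  extend-StringCond string (suc i) zero    2≤i =
    commuting-involutions (ρ H (suc i)) (ρ H zero) (H-inv (suc i)) (H-inv zero)
      (sym ∘ ρ-extend-commute i (nonzero 2≤i))
  extend-StringCond string (suc i) (suc j) 2≤i-j x =
    trans (evalWord-extend G A (i ∷ j ∷ i ∷ j ∷ []) x) (lift-id 1 (string i j 2≤i-j) x)

module _ {n k : ℕ} (G : LGraph n (suc k)) (A b : Fin n)
         (G-inv : ∀ l a → ρ G l (ρ G l a) ≡ a)
         (ρ-zero : ∀ a → ρ G zero a ≡ transpose A b a)
         (A-fixed : ∀ l → l ≢ zero → ρ G l A ≡ A)
         (G-ip : IntersectionProp G) where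

  private
    H : LGraph (suc n) (suc (suc k))
    H = extend G A

    open TranspositionGenerator G G-inv zero A b ρ-zero A-fixed using (InGen-transpose)

    τ : Fin (suc n) → Fin (suc n)
    τ = transpose zero (suc A)

    τ-involutive : ∀ x → τ (τ x) ≡ x
    τ-involutive = transpose-involutive zero (suc A)

    lift-τ : ∀ {g : Fin n → Fin n} → Injective _≡_ _≡_ g →
             ∀ x → lift 1 g (τ x) ≡ transpose zero (suc (g A)) (lift 1 g x)
    lift-τ {g} g-inj = transpose-conj (lift 1 g) (lift-injective g g-inj 1) zero (suc A)

    τ-conj-fixing : ∀ {g : Fin n → Fin n} → Injective _≡_ _≡_ g → g A ≡ A →
                    ∀ x → τ (lift 1 g (τ x)) ≡ lift 1 g x
    τ-conj-fixing {g} g-inj gA≡A x = begin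
      τ (lift 1 g (τ x))                           ≡⟨ cong τ (lift-τ g-inj x) ⟩
      τ (transpose zero (suc (g A)) (lift 1 g x))  ≡⟨ cong (λ y → τ (transpose zero (suc y) (lift 1 g x))) gA≡A ⟩
      τ (τ (lift 1 g x))                           ≡⟨ τ-involutive (lift 1 g x) ⟩
      lift 1 g x                                   ∎
      where open ≡-Reasoning

    τ-conj-moving : ∀ {g : Fin n → Fin n} → Injective _≡_ _≡_ g → g A ≢ A →
                    ∀ x → τ (lift 1 g (τ x)) ≡ lift 1 (transpose A (g A)) (τ (lift 1 g x))
    τ-conj-moving {g} g-inj gA≢A x = begin
      τ (lift 1 g (τ x))                            ≡⟨ cong τ (lift-τ g-inj x) ⟩
      τ (transpose zero (suc (g A)) y)              ≡⟨ transpose-conj τ τ-inj zero (suc (g A)) y ⟩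
      transpose (τ zero) (τ (suc (g A))) (τ y)      ≡⟨ cong (λ v → transpose (suc A) v (τ y)) τ-fixes-gA ⟩
      transpose (suc A) (suc (g A)) (τ y)           ≡⟨ transpose-suc A (g A) (τ y) ⟩
      lift 1 (transpose A (g A)) (τ y)              ∎
      where
      open ≡-Reasoning
      y : Fin (suc n)
      y = lift 1 g x
      τ-inj : Injective _≡_ _≡_ τ
      τ-inj = involutive⇒injective τ-involutive
      τ-fixes-gA : τ (suc (g A)) ≡ suc (g A)
      τ-fixes-gA = transpose-fix {i = zero} (λ ()) (gA≢A ∘ suc-injective)

    Lifted : Subset (suc k) → (Fin (suc n) → Fin (suc n)) → Set
    Lifted I f = ∃[ g ] (InGen G I g × (∀ x → f x ≡ lift 1 g x))

    data NormalForm (I : Subset (suc k)) (f : Fin (suc n) → Fin (suc n)) : Set where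
      lifted : Lifted I f → NormalForm I f
      via-τ  : ∀ {g h} → InGen G I g → InGen G I h → (∀ x → f x ≡ lift 1 g (τ (lift 1 h x))) →
               NormalForm I f

    NormalForm-cong : ∀ {I f f′} → NormalForm I f → (∀ x → f x ≡ f′ x) → NormalForm I f′
    NormalForm-cong (lifted (g , g∈I , f≗g)) f≗f′ = lifted (g , g∈I , λ x → trans (sym (f≗f′ x)) (f≗g x))
    NormalForm-cong (via-τ g∈I h∈I f≗gτh)    f≗f′ = via-τ g∈I h∈I (λ x → trans (sym (f≗f′ x)) (f≗gτh x))

    NormalForm-step : ∀ {I f l} → l ∈ true ∷ I → NormalForm I f → NormalForm I (ρ H l ∘ f)
    NormalForm-step {l = suc l} (there l∈I) (lifted (g , g∈I , f≗g)) =
      lifted (ρ G l ∘ g , InGen-∘ G (InGen-ρ G l∈I) g∈I ,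
              λ x → trans (cong (ρ H (suc l)) (f≗g x)) (ρ-extend-suc-lift G A l g x))
    NormalForm-step {l = suc l} (there l∈I) (via-τ {g} {h} g∈I h∈I f≗gτh) =
      via-τ (InGen-∘ G (InGen-ρ G l∈I) g∈I) h∈I
             (λ x → trans (cong (ρ H (suc l)) (f≗gτh x)) (ρ-extend-suc-lift G A l g (τ (lift 1 h x))))
    NormalForm-step {f = f} {l = zero} here (lifted (g , g∈I , f≗g)) =
      via-τ (InGen-id G) g∈I (λ x → trans (ρ-extend-zero G A (f x))
                                    (trans (cong τ (f≗g x)) (sym (lift-id 1 (λ _ → refl) _))))
    NormalForm-step {f = f} {l = zero} here (via-τ {g} {h} g∈I h∈I f≗gτh) = by-cases (g A ≟ A)
      where
      g-inj : Injective _≡_ _≡_ g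
      g-inj = InGen-injective G G-inv g∈I
      τf≗ : ∀ x → ρ H zero (f x) ≡ τ (lift 1 g (τ (lift 1 h x)))
      τf≗ x = trans (ρ-extend-zero G A (f x)) (cong τ (f≗gτh x))
      by-cases : Dec (g A ≡ A) → NormalForm _ (ρ H zero ∘ f)
      by-cases (yes gA≡A) = lifted (g ∘ h , InGen-∘ G g∈I h∈I ,
        λ x → trans (τf≗ x) (trans (τ-conj-fixing g-inj gA≡A (lift 1 h x)) (lift-∘ 1 g h x)))
      by-cases (no gA≢A)  = via-τ (InGen-transpose g∈I) (InGen-∘ G g∈I h∈I)
        λ x → trans (τf≗ x) (trans (τ-conj-moving g-inj gA≢A (lift 1 h x))
                                   (cong (lift 1 (transpose A (g A)) ∘ τ) (lift-∘ 1 g h x)))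

    normalForm : ∀ {I} w → All (_∈ true ∷ I) w → NormalForm I (evalWord H w)
    normalForm []      []          = lifted (id , InGen-id G , λ x → sym (lift-id 1 (λ _ → refl) x))
    normalForm (l ∷ w) (l∈I ∷ w∈I) = NormalForm-step l∈I (normalForm w w∈I)

    InGen⇒NormalForm : ∀ {β I f} → InGen H (β ∷ I) f → NormalForm I f
    InGen⇒NormalForm (w , w∈I , w≗f) = NormalForm-cong (normalForm w (All.map s∷p⊆inside∷p w∈I)) w≗f

    NormalForm⇒Lifted : ∀ {I f} → NormalForm I f → f zero ≡ zero → Lifted I f
    NormalForm⇒Lifted (lifted f-lifted) _  = f-lifted
    NormalForm⇒Lifted (via-τ _ _ f≗gτh)    f0 with trans (sym (f≗gτh zero)) f0
    ... | ()

    NormalForm⇒transpose : ∀ {I f y} → NormalForm I f → f zero ≡ suc y → InGen G I (transpose A y)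
    NormalForm⇒transpose (lifted (_ , _ , f≗g)) fy = ⊥-elim (0≢1+n (trans (sym (f≗g zero)) fy))
    NormalForm⇒transpose (via-τ g∈I _ f≗gτh) fy =
      InGen-cong G (InGen-transpose g∈I)
        (λ a → cong (λ v → transpose A v a) (suc-injective (trans (sym (f≗gτh zero)) fy)))

    outside-fixes-zero : ∀ {I} w → All (_∈ false ∷ I) w → evalWord H w zero ≡ zero
    outside-fixes-zero []          []         = refl
    outside-fixes-zero (suc l ∷ w) (_ ∷ w∈I)  = cong (ρ H (suc l)) (outside-fixes-zero w w∈I)

    InGen-outside-fixes-zero : ∀ {I f} → InGen H (false ∷ I) f → f zero ≡ zero
    InGen-outside-fixes-zero (w , w∈I , w≗f) = trans (sym (w≗f zero)) (outside-fixes-zero w w∈I)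

    InGen-∩-fixing : ∀ {β γ I J f} → InGen H (β ∷ I) f → InGen H (γ ∷ J) f → f zero ≡ zero →
                     InGen H ((β ∧ γ) ∷ (I ∩ J)) f
    InGen-∩-fixing {β} {γ} {I} {J} f∈I f∈J f0
      with NormalForm⇒Lifted (InGen⇒NormalForm f∈I) f0 | NormalForm⇒Lifted (InGen⇒NormalForm f∈J) f0
    ... | g , g∈I , f≗g | g′ , g′∈J , f≗g′ =
      InGen-cong H (InGen-extend G A (β ∧ γ) g∈I∩J) (sym ∘ f≗g)
      where
      g′≗g : ∀ a → g′ a ≡ g a
      g′≗g a = suc-injective (trans (sym (f≗g′ (suc a))) (f≗g (suc a)))
      g∈I∩J : InGen G (I ∩ J) g
      g∈I∩J = proj₁ (G-ip I J g) (g∈I , InGen-cong G g′∈J g′≗g)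

    InGen-∩-moving : ∀ {β γ I J f y} → InGen H (β ∷ I) f → InGen H (γ ∷ J) f → f zero ≡ suc y →
                     InGen H ((β ∧ γ) ∷ (I ∩ J)) f
    InGen-∩-moving {false} f∈I _ fy = ⊥-elim (0≢1+n (trans (sym (InGen-outside-fixes-zero f∈I)) fy))
    InGen-∩-moving {true} {false} _ f∈J fy = ⊥-elim (0≢1+n (trans (sym (InGen-outside-fixes-zero f∈J)) fy))
    InGen-∩-moving {true} {true} {I} {J} {f} {y} f∈I f∈J fy =
      InGen-cong H (InGen-∘ H (InGen-extend G A true s∈I∩J) (InGen-∘ H τ∈ f′∈I∩J)) undo
      where
      s : Fin n → Fin n
      s = transpose A y
      s∈I : InGen G I s
      s∈I = NormalForm⇒transpose (InGen⇒NormalForm f∈I) fy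
      s∈J : InGen G J s
      s∈J = NormalForm⇒transpose (InGen⇒NormalForm f∈J) fy
      s∈I∩J : InGen G (I ∩ J) s
      s∈I∩J = proj₁ (G-ip I J s) (s∈I , s∈J)
      τ∈ : ∀ {K} → InGen H (true ∷ K) τ
      τ∈ = InGen-cong H (InGen-ρ H here) (ρ-extend-zero G A)
      f′ : Fin (suc n) → Fin (suc n)
      f′ = τ ∘ lift 1 s ∘ f
      f′0 : f′ zero ≡ zero
      f′0 rewrite fy | transpose-matchʳ A y = transpose-matchʳ zero (suc A)
      f′∈ : ∀ {K} → InGen G K s → InGen H (true ∷ K) f → InGen H (true ∷ K) f′
      f′∈ s∈K f∈K = InGen-∘ H τ∈ (InGen-∘ H (InGen-extend G A true s∈K) f∈K)
      f′∈I∩J : InGen H (true ∷ (I ∩ J)) f′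
      f′∈I∩J = InGen-∩-fixing (f′∈ s∈I f∈I) (f′∈ s∈J f∈J) f′0
      undo : ∀ x → lift 1 s (τ (f′ x)) ≡ f x
      undo x = trans (cong (lift 1 s) (τ-involutive (lift 1 s (f x))))
                     (lift-involutive 1 {f = s} (transpose-involutive A y) (f x))

  extend-IntersectionProp : IntersectionProp H
  extend-IntersectionProp (β ∷ I) (γ ∷ J) f = forward , backward
    where
    forward : InGen H (β ∷ I) f × InGen H (γ ∷ J) f → InGen H ((β ∧ γ) ∷ (I ∩ J)) f
    forward (f∈I , f∈J) with f zero in f0
    ... | zero  = InGen-∩-fixing f∈I f∈J f0
    ... | suc y = InGen-∩-moving f∈I f∈J f0
    backward : InGen H ((β ∧ γ) ∷ (I ∩ J)) f → InGen H (β ∷ I) f × InGen H (γ ∷ J) f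
    backward f∈I∩J = InGen-mono H (p∩q⊆p (β ∷ I) (γ ∷ J)) f∈I∩J ,
                     InGen-mono H (p∩q⊆q (β ∷ I) (γ ∷ J)) f∈I∩J

lemma3p2 : ∀ (n k : ℕ) (G : LGraph n (suc k)) (A : Fin n) →
    IsCPR G →
    (∃[ b ] (G zero A ≡ just b)) →
    (∀ (l : Fin (suc k)) → l ≢ zero → G l A ≡ nothing) →
    (∀ (a b : Fin n) → G zero a ≡ just b → (a ≡ A ⊎ b ≡ A)) →
    IsCPR (extend G A) ×
    (Connected G → GroupIsSym G × GroupIsSym (extend G A))
lemma3p2 n k G A (G-lgraph , occurs , string , G-ip) (b , A—b) A-only-zero zero-edges-at-A =
  ( extend-IsLGraph G A G-lgraph
  , extend-AllLabelsOccur G A occurs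
  , extend-StringCond G A G-lgraph A-fixed string
  , extend-IntersectionProp G A b G-inv ρ-zero A-fixed G-ip )
  , λ connected →
      TranspositionGenerator.connected⇒GroupIsSym G G-inv zero A b ρ-zero A-fixed connected ,
      TranspositionGenerator.connected⇒GroupIsSym (extend G A) H-inv zero zero (suc A)
        (ρ-extend-zero G A) (ρ-extend-fix-zero G A) (extend-Connected G A connected)
  where
  G-inv : ∀ l a → ρ G l (ρ G l a) ≡ a
  G-inv = ρ-involutive G G-lgraph
  H-inv : ∀ l x → ρ (extend G A) l (ρ (extend G A) l x) ≡ x
  H-inv = ρ-involutive (extend G A) (extend-IsLGraph G A G-lgraph)
  ρ-zero : ∀ a → ρ G zero a ≡ transpose A b a
  ρ-zero = ρ-single-edge G G-lgraph zero A—b zero-edges-at-A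
  A-fixed : ∀ l → l ≢ zero → ρ G l A ≡ A
  A-fixed l l≢0 = cong (maybe id A) (A-only-zero l l≢0)
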